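{- Let $T=(T_1,T_2,\ldots)$ be a standard tower tableau with reading word $\alpha=\alpha_1\alpha_2\cdots\alpha_n$ ($n\ge 1$), and suppose that the cell $c$ labelled $1$ lies in the tower $T_i$, for some $i\ge 1$. Then the standard tower tableau $S$ of the word $\alpha'=\alpha_2\cdots\alpha_n$ is obtained from $T$ by the following three steps: (1) remove the cell $c$ (with its label $1$) from $T_i$ and push the remaining cells of $T_i$ down (each remaining cell of $T_i$ moves one unit down, keeping its label); (2) interchange the resulting tower with the adjacent tower $T_{i+1}$ (possibly empty), i.e. the tower in position $i$ becomes the (horizontally translated) old $T_{i+1}$ with its labels, and the tower in position $i+1$ becomes the modified tower from step (1) with its labels; all other towers are unchanged; (3) decrease every label of the resulting tableau by $1$.
   Context: A tower diagram is a finite sequence $\mathcal T=(\mathcal T_1,\mathcal T_2,\ldots)$ of towers; the $i$-th tower of size $k_i\ge 0$ consists of the unit cells $(i,0),(i,1),\ldots,(i,k_i-1)$, where the cell $(i,j)$ is the unit square $[i-1,i]\times[j,j+1]$ of the first quadrant, identified with its south-east corner; the cell $(i,j)$ is said to lie on the diagonal $x+y=i+j$. A tower tableau is a tower diagram with a positive integer label on each cell. Sliding. For a positive integer $a$ and a tail $(\mathcal T_p,\mathcal T_{p+1},\ldots)$ of a tower diagram (towers keep their absolute positions), $a^{\searrow}(\mathcal T_p,\ldots)$ either adds exactly one cell or terminates without result, as follows. (S1) If no tower $\mathcal T_t$, $t\ge p$, has a cell on the diagonal $x+y=a-1$: (a) if no such tower has a cell on $x+y=a$ (then $\mathcal T_a=\varnothing$),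 add the cell $(a,0)$; (b) if $(a,0)\in\mathcal T_a$ and $(a,1)\notin\mathcal T_a$, terminate; (c) if $(a,0),(a,1)\in\mathcal T_a$, the result is $(a+1)^{\searrow}(\mathcal T_{a+1},\ldots)$ (towers up to $\mathcal T_a$ unchanged), terminating iff that does. (S2) Otherwise let $\mathcal T_i$, $i\ge p$, be the leftmost such tower having a cell on $x+y=a-1$, namely $(i,a-1-i)$: (a) if $(i,a-i)\notin\mathcal T_i$, add the cell $(i,a-i)$; (b) if $(i,a-i)\in\mathcal T_i$ but $(i,a-i+1)\notin\mathcal T_i$, terminate; (c) if both lie in $\mathcal T_i$, the result is $(a+1)^{\searrow}(\mathcal T_{i+1},\ldots)$ (towers up to $\mathcal T_i$ unchanged), terminating iff that does. Sliding $a$ into $\mathcal T$ means $a^{\searrow}\mathcal T:=a^{\searrow}(\mathcal T_1,\mathcal T_2,\ldots)$. Standard tower tableaux. Sliding a word $\alpha_1\cdots\alpha_n$ of positive integers letter by letter into the empty diagram, if no step terminates, and labelling the cell created by the $k$-th letter by $k$, yields the standard tower tableau of the word; the word is its reading word. (This happens exactly when the word is a reduced word of a permutation, and a standard tower tableau determines its reading word.) -}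

module Defs where

open import Data.Nat using (ℕ; zero; suc; _+_; _∸_; _≤_; _<_; _≤ᵇ_; _≡ᵇ_; pred)
open import Data.Bool using (Bool; true; false; if_then_else_; not)
open import Data.List using (List; []; _∷_; _++_; length; map; filter; [_])
open import Data.Maybe using (Maybe; just; nothing)
open import Relation.Nullary.Decidable using (¬?)
open import Data.Nat using (_≟_)

-- A tower tableau: a finite list of towers; the k-th entry of the list
-- (k = 1, 2, ...) is the tower T_k, given as the list of its labels from
-- the bottom cell (k,0) upwards.
Tower : Set
Tower = List ℕ

Tableau : Set
Tableau = List Tower

-- i-th tower (1-indexed); index 0 and indices past the end give the empty tower
towerAt : List Tower → ℕ → Tower
towerAt []       _             = []
towerAt (t ∷ ts) zero          = []
towerAt (t ∷ ts) (suc zero)    = t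
towerAt (t ∷ ts) (suc (suc k)) = towerAt ts (suc k)

size : Tableau → ℕ → ℕ
size T i = length (towerAt T i)

-- does the tower T_t contain a cell on the diagonal x+y=d ?
-- (cells of T_t are (t,0),...,(t,k_t-1), so: 1 ≤ t ≤ d < t + k_t)
hasCellOnᵇ : Tableau → ℕ → ℕ → Bool
hasCellOnᵇ T t d = if (1 ≤ᵇ t) then ((t ≤ᵇ d) Data.Bool.∧ (suc d ≤ᵇ t + size T t)) else false

searchFrom : Tableau → ℕ → ℕ → ℕ → Maybe ℕ
searchFrom T d p zero    = if hasCellOnᵇ T p d then just p else nothing
searchFrom T d p (suc c) = if hasCellOnᵇ T p d then just p else searchFrom T d (suc p) c

-- leftmost tower T_t, t ≥ p, having a cell on the diagonal x+y=d
-- (such a t satisfies t ≤ d, so it suffices to search p ≤ t ≤ p + d)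
leftmost : Tableau → ℕ → ℕ → Maybe ℕ
leftmost T p d = searchFrom T d p d

-- The result is `just t` if the slide
-- adds one cell, namely on top of the tower T_t (in both (S1a) and (S2a)
-- the added cell is the top of its tower), and `nothing` if it terminates.
-- The first argument is fuel; since every recursive call (S1c)/(S2c)
-- strictly increases p and once p exceeds the number of towers case (S1a)
-- applies, fuel  length T + 2  is always sufficient (see `slideInto`).
slide : ℕ → ℕ → ℕ → Tableau → Maybe ℕ
slide zero     a p T = nothing
slide (suc f) a p T with leftmost T p (a ∸ 1)
... | nothing with leftmost T p a
...   | nothing = just a
...   | just _  with size T a
...     | zero          = nothing   -- excluded by the paper's remark (then T_a = ∅)
...     | suc zero      = nothing
...     | suc (suc _)   = slide f (suc a) (suc a) T
-- (S2): T_i is the leftmost such tower, with cell (i, a-1-i)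
slide (suc f) a p T | just i with size T i ≤ᵇ a ∸ i
...   | true  = just i                                   -- (S2a): add (i, a-i)
...   | false with size T i ≡ᵇ suc (a ∸ i)
...     | true  = nothing
...     | false = slide f (suc a) (suc i) T

slideInto : ℕ → Tableau → Maybe ℕ
slideInto a T = slide (suc (suc (length T))) a 1 T

addOnTop : Tableau → ℕ → ℕ → Tableau
addOnTop []       zero          ℓ = []
addOnTop (x ∷ T)  zero          ℓ = x ∷ T
addOnTop []       (suc zero)    ℓ = [ ℓ ] ∷ []
addOnTop (x ∷ T)  (suc zero)    ℓ = (x ++ [ ℓ ]) ∷ T
addOnTop []       (suc (suc k)) ℓ = [] ∷ addOnTop [] (suc k) ℓ
addOnTop (x ∷ T)  (suc (suc k)) ℓ = x ∷ addOnTop T (suc k) ℓ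

insertWord : ℕ → Tableau → List ℕ → Maybe Tableau
insertWord k T []       = just T
insertWord k T (a ∷ as) with slideInto a T
... | nothing = nothing
... | just t  = insertWord (suc k) (addOnTop T t k) as

standardTableau : List ℕ → Maybe Tableau
standardTableau w = insertWord 1 [] w

-- remove the cell labelled ℓ from a tower; the cells above it move down
removeLabel : ℕ → Tower → Tower
removeLabel ℓ = filter (λ x → ¬? (x ≟ ℓ))

transformedTower : Tableau → ℕ → ℕ → Tower
transformedTower T i j =
  map pred
    (if j ≡ᵇ i then towerAt T (suc i)
     else if j ≡ᵇ suc i then removeLabel 1 (towerAt T i)
     else towerAt T j)

-- Let S and T be the standard tower tableaux of α′ and of a α′.  Along α′ one keeps the
-- invariant that T arises from S by raising all labels by one, exchanging towers a and
-- a+1 and putting a cell labelled 1 under tower a, and that tower a of S is not higher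
-- than tower a+1.  In terms of heights, t_a = s_{a+1} + 1, t_{a+1} = s_a and t_j = s_j
-- otherwise, with s_a ≤ s_{a+1}; hence every diagonal met by tower a or a+1 of S is met
-- by tower a of T.  Sliding a letter into T and into S therefore runs through the same
-- cases, except that a cell landing on tower a (resp. a+1) of T lands on tower a+1
-- (resp. a) of S; the latter happens only when s_a < s_{a+1}, which keeps the invariant.
-- At the end the label 1 sits at the bottom of tower a of T, so i = a, and the invariant
-- says exactly that S is obtained from T by steps (1)–(3).

module Submission where

open import Defs
open import Data.Bool using (true; false; T)
open import Data.Empty using (⊥-elim)
open import Data.List using (List; []; _∷_; _++_; [_]; length; map)
open import Data.List.Properties using (++-assoc; length-++; length-map; map-++; map-∘; map-id; filter-all)
open import Data.List.Membership.Propositional using (_∈_; _∉_)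
open import Data.List.Membership.Propositional.Properties using (∈-map⁻)
open import Data.List.Relation.Unary.All as All using (All; []; _∷_)
open import Data.List.Relation.Unary.All.Properties using (++⁺; map⁺)
open import Data.Maybe using (Maybe; just; nothing)
open import Data.Nat using (ℕ; zero; suc; pred; _+_; _∸_; _≤_; _<_; _≤ᵇ_; _≡ᵇ_; z≤n; s≤s; _≤?_; _≟_)
open import Data.Nat.Properties
open import Data.Product using (Σ; _×_; _,_)
open import Data.Sum using (_⊎_; inj₁; inj₂)
open import Function using (_∘_)
open import Relation.Binary using (tri<; tri≈; tri>)
open import Relation.Binary.PropositionalEquality hiding ([_])
open import Relation.Nullary using (¬_; ¬?; Dec; yes; no; does; _×-dec_)
open import Relation.Nullary.Decidable using (dec-true; dec-false; map′)

-- Cells on diagonals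

-- Sliding only looks at the heights of the towers, so the combinatorics is stated for a
-- height function k, later instantiated with size T.
record OnDiagonal (k : ℕ → ℕ) (t d : ℕ) : Set where
  constructor cell
  field
    index-positive : 1 ≤ t
    index≤diagonal : t ≤ d
    diagonal<top   : d < t + k t

onDiagonal? : ∀ k t d → Dec (OnDiagonal k t d)
onDiagonal? k t d = map′ (λ (p , q , r) → cell p q r) (λ (cell p q r) → p , q , r)
                         (1 ≤? t ×-dec t ≤? d ×-dec suc d ≤? t + k t)

hasCellOnᵇ≡onDiagonal? : ∀ T t d → hasCellOnᵇ T t d ≡ does (onDiagonal? (size T) t d)
hasCellOnᵇ≡onDiagonal? T t d with 1 ≤ᵇ t
... | true  = refl
... | false = refl

hasCellOnᵇ-true : ∀ {T t d} → OnDiagonal (size T) t d → hasCellOnᵇ T t d ≡ true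
hasCellOnᵇ-true {T} {t} {d} on = trans (hasCellOnᵇ≡onDiagonal? T t d) (dec-true (onDiagonal? (size T) t d) on)

hasCellOnᵇ-false : ∀ {T t d} → ¬ OnDiagonal (size T) t d → hasCellOnᵇ T t d ≡ false
hasCellOnᵇ-false {T} {t} {d} ¬on = trans (hasCellOnᵇ≡onDiagonal? T t d) (dec-false (onDiagonal? (size T) t d) ¬on)

onDiagonal-resize : ∀ {k k′ t d} → k t ≡ k′ t → OnDiagonal k t d → OnDiagonal k′ t d
onDiagonal-resize {t = t} k≡k′ (cell 1≤t t≤d d<) = cell 1≤t t≤d (subst (λ h → _ < t + h) k≡k′ d<)

NoneOn : (ℕ → ℕ) → ℕ → ℕ → Set
NoneOn k p d = ∀ u → p ≤ u → ¬ OnDiagonal k u d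

record LeftmostOn (k : ℕ → ℕ) (p d t : ℕ) : Set where
  constructor leftmostOn
  field
    from    : p ≤ t
    hit     : OnDiagonal k t d
    skipped : ∀ u → p ≤ u → u < t → ¬ OnDiagonal k u d
open LeftmostOn

module _ {k : ℕ → ℕ} where

  onDiagonal⇒≤ : ∀ {t d} → OnDiagonal k t d → t ≤ d
  onDiagonal⇒≤ (cell _ t≤d _) = t≤d

  onDiagonal-pred : ∀ {t d} → t < d → OnDiagonal k t d → OnDiagonal k t (d ∸ 1)
  onDiagonal-pred {d = suc _} (s≤s t≤d) (cell 1≤t _ d<) = cell 1≤t t≤d (<⇒≤ d<)

  ¬onDiagonal-beyond : ∀ {u d} → d < u → ¬ OnDiagonal k u d
  ¬onDiagonal-beyond d<u on = <⇒≱ d<u (onDiagonal⇒≤ on)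

  noneOn-beyond : ∀ {p d} → d < p → NoneOn k p d
  noneOn-beyond d<p u p≤u = ¬onDiagonal-beyond (<-≤-trans d<p p≤u)

  bottom-onDiagonal : ∀ {t} → 1 ≤ t → 1 ≤ k t → OnDiagonal k t t
  bottom-onDiagonal {t} 1≤t 1≤kt = cell 1≤t ≤-refl (m<m+n t 1≤kt)

  noneOn-extend : ∀ {p d} → ¬ OnDiagonal k p d → NoneOn k (suc p) d → NoneOn k p d
  noneOn-extend ¬on none u p≤u with m≤n⇒m<n∨m≡n p≤u
  ... | inj₁ p<u  = none u p<u
  ... | inj₂ refl = ¬on

  leftmostOn-here : ∀ {p d} → OnDiagonal k p d → LeftmostOn k p d p
  leftmostOn-here on = leftmostOn ≤-refl on (λ u p≤u u<p → ⊥-elim (<⇒≱ u<p p≤u))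

  leftmostOn-extend : ∀ {p d t} → ¬ OnDiagonal k p d → LeftmostOn k (suc p) d t → LeftmostOn k p d t
  leftmostOn-extend ¬on L = leftmostOn (<⇒≤ (from L)) (hit L) skipped′
    where
    skipped′ : ∀ u → _ ≤ u → u < _ → ¬ OnDiagonal k u _
    skipped′ u p≤u u<t with m≤n⇒m<n∨m≡n p≤u
    ... | inj₁ p<u  = skipped L u p<u u<t
    ... | inj₂ refl = ¬on

  leftmostOn-unique : ∀ {p d t t′} → LeftmostOn k p d t → LeftmostOn k p d t′ → t ≡ t′
  leftmostOn-unique {t = t} {t′} L L′ with <-cmp t t′
  ... | tri< t<t′ _ _ = ⊥-elim (skipped L′ t (from L) t<t′ (hit L))
  ... | tri≈ _ t≡t′ _ = t≡t′
  ... | tri> _ _ t′<t = ⊥-elim (skipped L t′ (from L′) t′<t (hit L′))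

data Search (k : ℕ → ℕ) (p d : ℕ) : Maybe ℕ → Set where
  found : ∀ {t} → LeftmostOn k p d t → Search k p d (just t)
  none  : NoneOn k p d → Search k p d nothing

searchFrom-search : ∀ T d p c → d ≤ p + c → Search (size T) p d (searchFrom T d p c)
searchFrom-search T d p zero d≤p with onDiagonal? (size T) p d
... | yes on rewrite hasCellOnᵇ-true {T} on = found (leftmostOn-here on)
... | no ¬on rewrite hasCellOnᵇ-false {T} ¬on =
  none (noneOn-extend ¬on (noneOn-beyond (s≤s (subst (d ≤_) (+-identityʳ p) d≤p))))
searchFrom-search T d p (suc c) d≤ with onDiagonal? (size T) p d
... | yes on rewrite hasCellOnᵇ-true {T} on = found (leftmostOn-here on)
... | no ¬on rewrite hasCellOnᵇ-false {T} ¬on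
  with searchFrom T d (suc p) c | searchFrom-search T d (suc p) c (subst (d ≤_) (+-suc p c) d≤)
...   | just _  | found L = found (leftmostOn-extend ¬on L)
...   | nothing | none N  = none (noneOn-extend ¬on N)

leftmost-search : ∀ T p d → Search (size T) p d (leftmost T p d)
leftmost-search T p d = searchFrom-search T d p d (m≤n+m d p)

leftmost≡just : ∀ {T p d t} → LeftmostOn (size T) p d t → leftmost T p d ≡ just t
leftmost≡just {T} {p} {d} L with leftmost T p d | leftmost-search T p d
... | just _  | found L′ = cong just (leftmostOn-unique L′ L)
... | nothing | none N   = ⊥-elim (N _ (from L) (hit L))

leftmost≡nothing : ∀ {T p d} → NoneOn (size T) p d → leftmost T p d ≡ nothing
leftmost≡nothing {T} {p} {d} N with leftmost T p d | leftmost-search T p d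
... | just _  | found L = ⊥-elim (N _ (from L) (hit L))
... | nothing | none _  = refl

-- Sliding as a relation on tower heights

-- Slides k a p r: sliding a into the towers p, p+1, ... adds a cell on top of tower r.
-- In (S1c) the tower met on diagonal a is necessarily tower a, so only its height is kept.
data Slides (k : ℕ → ℕ) : ℕ → ℕ → ℕ → Set where
  S1a : ∀ {a p} → NoneOn k p (a ∸ 1) → NoneOn k p a → Slides k a p a
  S1c : ∀ {a p r} → 1 ≤ a → p ≤ a → NoneOn k p (a ∸ 1) → 2 ≤ k a →
        Slides k (suc a) (suc a) r → Slides k a p r
  S2a : ∀ {a p i} → LeftmostOn k p (a ∸ 1) i → i + k i ≤ a → Slides k a p i
  S2c : ∀ {a p i r} → LeftmostOn k p (a ∸ 1) i → suc a < i + k i →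
        Slides k (suc a) (suc i) r → Slides k a p r

steps : ∀ {k a p r} → Slides k a p r → ℕ
steps (S1a _ _)       = 1
steps (S1c _ _ _ _ D) = suc (steps D)
steps (S2a _ _)       = 1
steps (S2c _ _ D)     = suc (steps D)

module _ {i a k : ℕ} (i≤a : i ≤ a) where

  +≤⇒≤∸ : i + k ≤ a → k ≤ a ∸ i
  +≤⇒≤∸ h = m+n≤o⇒m≤o∸n k (subst (_≤ a) (+-comm i k) h)

  ≤∸⇒+≤ : k ≤ a ∸ i → i + k ≤ a
  ≤∸⇒+≤ h = subst (_≤ a) (+-comm k i) (m≤o∸n⇒m+n≤o k i≤a h)

  private
    i+2+[a∸i]≡2+a : i + suc (suc (a ∸ i)) ≡ suc (suc a)
    i+2+[a∸i]≡2+a = trans (trans (+-suc i _) (cong suc (+-suc i _))) (cong (suc ∘ suc) (m+[n∸m]≡n i≤a))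

  1+a<+⇒1+[a∸i]< : suc a < i + k → suc (a ∸ i) < k
  1+a<+⇒1+[a∸i]< h = +-cancelˡ-≤ i _ k (subst (_≤ i + k) (sym i+2+[a∸i]≡2+a) h)

  1+[a∸i]<⇒1+a<+ : suc (a ∸ i) < k → suc a < i + k
  1+[a∸i]<⇒1+a<+ h = subst (_≤ i + k) i+2+[a∸i]≡2+a (+-monoʳ-≤ i h)

≤ᵇ≡true⇒≤ : ∀ {m n} → (m ≤ᵇ n) ≡ true → m ≤ n
≤ᵇ≡true⇒≤ {m} {n} e = ≤ᵇ⇒≤ m n (subst T (sym e) _)

≤ᵇ≡false⇒≰ : ∀ {m n} → (m ≤ᵇ n) ≡ false → ¬ m ≤ n
≤ᵇ≡false⇒≰ e m≤n = subst T e (≤⇒≤ᵇ m≤n)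

≡ᵇ≡false⇒≢ : ∀ {m n} → (m ≡ᵇ n) ≡ false → m ≢ n
≡ᵇ≡false⇒≢ {m} {n} e m≡n = subst T e (≡⇒≡ᵇ m n m≡n)

≤⇒≤ᵇ≡true : ∀ {m n} → m ≤ n → (m ≤ᵇ n) ≡ true
≤⇒≤ᵇ≡true {m} {n} = dec-true (m ≤? n)

≰⇒≤ᵇ≡false : ∀ {m n} → ¬ m ≤ n → (m ≤ᵇ n) ≡ false
≰⇒≤ᵇ≡false {m} {n} = dec-false (m ≤? n)

≢⇒≡ᵇ≡false : ∀ {m n} → m ≢ n → (m ≡ᵇ n) ≡ false
≢⇒≡ᵇ≡false {m} {n} = dec-false (m ≟ n)

≡⇒≡ᵇ≡true : ∀ {m n} → m ≡ n → (m ≡ᵇ n) ≡ true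
≡⇒≡ᵇ≡true {m} {n} = dec-true (m ≟ n)

leftmostOn⇒≤ : ∀ {k p d t} → LeftmostOn k p d t → t ≤ d
leftmostOn⇒≤ {k} L = onDiagonal⇒≤ {k} (hit L)

leftmostOn-pred⇒≤ : ∀ {k p a i} → LeftmostOn k p (a ∸ 1) i → i ≤ a
leftmostOn-pred⇒≤ {k} {a = a} L = ≤-trans (leftmostOn⇒≤ {k} L) (m∸n≤m a 1)

slide-sound : ∀ f a p T {r} → slide f a p T ≡ just r → Slides (size T) a p r
slide-sound zero a p T ()
slide-sound (suc f) a p T eq with leftmost T p (a ∸ 1) | leftmost-search T p (a ∸ 1)
... | nothing | none N with leftmost T p a | leftmost-search T p a
...   | nothing | none N′ with refl ← eq = S1a N N′
...   | just t  | found L with size T a in ka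
...     | suc (suc _) = S1c (≤-trans 1≤t (leftmostOn⇒≤ L)) (≤-trans (from L) (leftmostOn⇒≤ L)) N
                            (subst (2 ≤_) (sym ka) (s≤s (s≤s z≤n))) (slide-sound f (suc a) (suc a) T eq)
  where 1≤t = OnDiagonal.index-positive (hit L)
slide-sound (suc f) a p T eq | just i | found L with size T i ≤ᵇ a ∸ i in top
... | true with refl ← eq = S2a L (≤∸⇒+≤ i≤a (≤ᵇ≡true⇒≤ top))
  where i≤a = leftmostOn-pred⇒≤ L
... | false with size T i ≡ᵇ suc (a ∸ i) in next
...   | false = S2c L (1+[a∸i]<⇒1+a<+ i≤a
                           (≤∧≢⇒< (≰⇒> (≤ᵇ≡false⇒≰ top)) (≢-sym (≡ᵇ≡false⇒≢ next))))
                  (slide-sound f (suc a) (suc i) T eq)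
  where i≤a = leftmostOn-pred⇒≤ L

slide-complete : ∀ {f a p r} T (D : Slides (size T) a p r) → steps D ≤ f → slide f a p T ≡ just r
slide-complete T (S1a N N′) (s≤s _) rewrite leftmost≡nothing {T} N | leftmost≡nothing {T} N′ = refl
slide-complete {a = a} {p} T (S1c 1≤a p≤a N 2≤ka D) (s≤s st) rewrite leftmost≡nothing {T} N
  with leftmost T p a | leftmost-search T p a
... | nothing | none N′ = ⊥-elim (N′ a p≤a (bottom-onDiagonal 1≤a (≤-trans (s≤s z≤n) 2≤ka)))
... | just _  | found _ with size T a | 2≤ka
...   | suc (suc _) | s≤s (s≤s _) = slide-complete T D st
slide-complete T (S2a L top) (s≤s _)
  rewrite leftmost≡just {T} L | ≤⇒≤ᵇ≡true (+≤⇒≤∸ (leftmostOn-pred⇒≤ L) top) = refl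
slide-complete T (S2c L tall D) (s≤s st)
  with 1+a<+⇒1+[a∸i]< (leftmostOn-pred⇒≤ L) tall
... | a∸i+1<k
  rewrite leftmost≡just {T} L
        | ≰⇒≤ᵇ≡false (<⇒≱ (<-trans (n<1+n _) a∸i+1<k))
        | ≢⇒≡ᵇ≡false (>⇒≢ a∸i+1<k) = slide-complete T D st

nonempty⇒≤length : ∀ T {t} → 1 ≤ t → 1 ≤ size T t → t ≤ length T
nonempty⇒≤length (_ ∷ _) {suc zero}    _ _ = s≤s z≤n
nonempty⇒≤length (_ ∷ T) {suc (suc t)} _ h = s≤s (nonempty⇒≤length T (s≤s z≤n) h)

onDiagonal⇒nonempty : ∀ {k t d} → OnDiagonal k t d → 1 ≤ k t
onDiagonal⇒nonempty {k} {t} (cell _ t≤d d<) =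
  +-cancelˡ-< t 0 (k t) (subst (_< t + k t) (sym (+-identityʳ t)) (≤-<-trans t≤d d<))

onDiagonal⇒≤length : ∀ T {t d} → OnDiagonal (size T) t d → t ≤ length T
onDiagonal⇒≤length T on = nonempty⇒≤length T (OnDiagonal.index-positive on) (onDiagonal⇒nonempty on)

+-suc-≤ : ∀ m {p q n} → p ≤ q → m + suc q ≤ n → suc m + p ≤ n
+-suc-≤ m {p} p≤q h = ≤-trans (≤-reflexive (sym (+-suc m p))) (≤-trans (+-monoʳ-≤ m (s≤s p≤q)) h)

steps-bound : ∀ T {a p r} (D : Slides (size T) a p r) → p ≤ suc (length T) →
              steps D + p ≤ suc (suc (length T))
steps-bound _ (S1a _ _) p≤ = s≤s p≤
steps-bound T (S1c 1≤a p≤a _ 2≤ka D) _ =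
  +-suc-≤ (steps D) p≤a (steps-bound T D (s≤s (nonempty⇒≤length T 1≤a (≤-trans (s≤s z≤n) 2≤ka))))
steps-bound _ (S2a _ _) p≤ = s≤s p≤
steps-bound T (S2c L _ D) _ =
  +-suc-≤ (steps D) (from L) (steps-bound T D (s≤s (onDiagonal⇒≤length T (hit L))))

slideInto-complete : ∀ T {a r} → Slides (size T) a 1 r → slideInto a T ≡ just r
slideInto-complete T D =
  slide-complete T D (m+n≤o⇒m≤o (steps D) (steps-bound T D (s≤s z≤n)))

Slides-start≤result : ∀ {k a p r} → Slides k a p r → p ≤ a → p ≤ r
Slides-start≤result (S1a _ _)         p≤a = p≤a
Slides-start≤result (S1c _ p≤a _ _ D) _   = ≤-trans (≤-trans p≤a (n≤1+n _)) (Slides-start≤result D ≤-refl)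
Slides-start≤result (S2a L _)         _   = from L
Slides-start≤result {k} (S2c L _ D)   _   =
  ≤-trans (≤-trans (from L) (n≤1+n _)) (Slides-start≤result D (s≤s (leftmostOn-pred⇒≤ {k} L)))

module _ {k k′ : ℕ → ℕ} {p : ℕ} (agree : ∀ j → p ≤ j → k j ≡ k′ j) where

  noneOn-agree : ∀ {q d} → p ≤ q → NoneOn k q d → NoneOn k′ q d
  noneOn-agree p≤q N u q≤u on = N u q≤u (onDiagonal-resize (sym (agree u (≤-trans p≤q q≤u))) on)

  leftmostOn-agree : ∀ {q d t} → p ≤ q → LeftmostOn k q d t → LeftmostOn k′ q d t
  leftmostOn-agree p≤q L =
    leftmostOn (from L) (onDiagonal-resize (agree _ (≤-trans p≤q (from L))) (hit L))
      (λ u q≤u u<t on → skipped L u q≤u u<t (onDiagonal-resize (sym (agree u (≤-trans p≤q q≤u))) on))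

  Slides-agree : ∀ {a q r} → p ≤ q → Slides k a q r → Slides k′ a q r
  Slides-agree p≤q (S1a N N′) = S1a (noneOn-agree p≤q N) (noneOn-agree p≤q N′)
  Slides-agree p≤q (S1c 1≤a q≤a N 2≤ka D) =
    S1c 1≤a q≤a (noneOn-agree p≤q N) (subst (2 ≤_) (agree _ p≤a) 2≤ka)
        (Slides-agree (≤-trans p≤a (n≤1+n _)) D)
    where p≤a = ≤-trans p≤q q≤a
  Slides-agree p≤q (S2a L top) =
    S2a (leftmostOn-agree p≤q L) (subst (λ h → _ + h ≤ _) (agree _ (≤-trans p≤q (from L))) top)
  Slides-agree p≤q (S2c L tall D) =
    S2c (leftmostOn-agree p≤q L) (subst (λ h → _ < _ + h) (agree _ (≤-trans p≤q (from L))) tall)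
        (Slides-agree (≤-trans (≤-trans p≤q (from L)) (n≤1+n _)) D)

module _ {k : ℕ → ℕ} where

  noneOn-shrink : ∀ {p d} → NoneOn k p d → NoneOn k (suc p) d
  noneOn-shrink N u p<u = N u (<⇒≤ p<u)

  leftmostOn-shrink : ∀ {p d t} → ¬ OnDiagonal k p d → LeftmostOn k p d t → LeftmostOn k (suc p) d t
  leftmostOn-shrink {p} {t = t} ¬on L with m≤n⇒m<n∨m≡n (from L)
  ... | inj₁ p<t  = leftmostOn p<t (hit L) (λ u p<u → skipped L u (<⇒≤ p<u))
  ... | inj₂ refl = ⊥-elim (¬on (hit L))

  Slides-skip : ∀ {a q r} → Slides k a q r → ¬ OnDiagonal k q (a ∸ 1) → ¬ OnDiagonal k q a →
                Slides k a (suc q) r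
  Slides-skip (S1a N N′) _ _ = S1a (noneOn-shrink N) (noneOn-shrink N′)
  Slides-skip {a} (S1c 1≤a q≤a N 2≤ka D) _ ¬on with m≤n⇒m<n∨m≡n q≤a
  ... | inj₁ q<a  = S1c 1≤a q<a (noneOn-shrink N) 2≤ka D
  ... | inj₂ refl = ⊥-elim (¬on (bottom-onDiagonal 1≤a (≤-trans (s≤s z≤n) 2≤ka)))
  Slides-skip (S2a L top)     ¬on _ = S2a (leftmostOn-shrink ¬on L) top
  Slides-skip (S2c L tall D) ¬on _ = S2c (leftmostOn-shrink ¬on L) tall D

-- Exchanging two adjacent towers

data Around (a : ℕ) : ℕ → Set where
  below : ∀ {u} → u < a → Around a u
  at    : Around a a
  next  : Around a (suc a)
  above : ∀ {u} → suc a < u → Around a u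

around : ∀ a u → Around a u
around a u with <-cmp u a
... | tri< u<a _ _  = below u<a
... | tri≈ _ refl _ = at
... | tri> _ _ a<u with m≤n⇒m<n∨m≡n a<u
...   | inj₁ a+1<u = above a+1<u
...   | inj₂ refl  = next

module Transposition
  {s t : ℕ → ℕ} {a : ℕ} (1≤a : 1 ≤ a)
  (t-at : t a ≡ suc (s (suc a))) (t-next : t (suc a) ≡ s a)
  (t-away : ∀ j → j ≢ a → j ≢ suc a → t j ≡ s j)
  (x≤y : s a ≤ s (suc a)) where

  data Simulated (b p : ℕ) : ℕ → Set where
    moved-up   : Slides s b p (suc a) → Simulated b p a
    moved-down : Slides s b p a → s a < s (suc a) → Simulated b p (suc a)
    unmoved    : ∀ {r} → r ≢ a → r ≢ suc a → Slides s b p r → Simulated b p r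

  t≡s-below : ∀ {u} → u < a → t u ≡ s u
  t≡s-below u<a = t-away _ (<⇒≢ u<a) (<⇒≢ (m<n⇒m<1+n u<a))

  t≡s-above : ∀ {u} → suc a < u → t u ≡ s u
  t≡s-above a+1<u = t-away _ (>⇒≢ (<-trans (n<1+n _) a+1<u)) (>⇒≢ a+1<u)

  unmoved-below : ∀ {b p r} → r < a → Slides s b p r → Simulated b p r
  unmoved-below r<a = unmoved (<⇒≢ r<a) (<⇒≢ (m<n⇒m<1+n r<a))

  unmoved-above : ∀ {b p r} → suc a < r → Slides s b p r → Simulated b p r
  unmoved-above a+1<r = unmoved (>⇒≢ (<-trans (n<1+n _) a+1<r)) (>⇒≢ a+1<r)

  Simulated-prepend : ∀ {b p b′ p′ r} → (∀ {r′} → Slides s b′ p′ r′ → Slides s b p r′) →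
                      Simulated b′ p′ r → Simulated b p r
  Simulated-prepend step (moved-up D)      = moved-up (step D)
  Simulated-prepend step (moved-down D lt) = moved-down (step D) lt
  Simulated-prepend step (unmoved ≢a ≢a+1 D) = unmoved ≢a ≢a+1 (step D)

  a+n≡a : ∀ {n} → n ≡ 0 → a + n ≡ a
  a+n≡a refl = +-identityʳ a

  ¬onDiagonal-s-at : ∀ {e} → a + s a ≤ e → ¬ OnDiagonal s a e
  ¬onDiagonal-s-at a+x≤e (cell _ _ e<a+x) = <⇒≱ e<a+x a+x≤e

  a+t-at : a + t a ≡ suc (a + s (suc a))
  a+t-at = trans (cong (a +_) t-at) (+-suc a _)

  onDiagonal-t-at : ∀ {e} → a ≤ e → e ≤ a + s (suc a) → OnDiagonal t a e
  onDiagonal-t-at {e} a≤e e≤ = cell 1≤a a≤e (subst (e <_) (sym a+t-at) (s≤s e≤))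

  onDiagonal-t-at⇒≤ : ∀ {e} → OnDiagonal t a e → e ≤ a + s (suc a)
  onDiagonal-t-at⇒≤ {e} (cell _ _ e<) = ≤-pred (subst (e <_) a+t-at e<)

  onDiagonal-t-next : ∀ {e} → a < e → e ≤ a + s a → OnDiagonal t (suc a) e
  onDiagonal-t-next a<e e≤ = cell (s≤s z≤n) a<e (subst (λ h → _ < suc a + h) (sym t-next) (s≤s e≤))

  onDiagonal-t-next⇒≤ : ∀ {e} → OnDiagonal t (suc a) e → e ≤ a + s a
  onDiagonal-t-next⇒≤ (cell _ _ e<) = ≤-pred (subst (λ h → _ < suc a + h) t-next e<)

  -- Since s a ≤ s (suc a), towers a and a+1 of s meet only diagonals met by tower a of t.
  onDiagonal-s⇒t : ∀ {p u e} → p ≤ a → p ≤ u → OnDiagonal s u e →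
                   Σ ℕ λ v → p ≤ v × v ≤ u × OnDiagonal t v e
  onDiagonal-s⇒t {u = u} p≤a p≤u on@(cell _ u≤e e<) with around a u
  ... | below u<a   = u , p≤u , ≤-refl , onDiagonal-resize (sym (t≡s-below u<a)) on
  ... | above a+1<u = u , p≤u , ≤-refl , onDiagonal-resize (sym (t≡s-above a+1<u)) on
  ... | at          = a , p≤a , ≤-refl , onDiagonal-t-at u≤e (≤-trans (<⇒≤ e<) (+-monoʳ-≤ a x≤y))
  ... | next        = a , p≤a , n≤1+n a , onDiagonal-t-at (<⇒≤ u≤e) (≤-pred e<)

  noneOn-transfer : ∀ {p e} → p ≤ a → NoneOn t p e → NoneOn s p e
  noneOn-transfer p≤a N u p≤u on with onDiagonal-s⇒t p≤a p≤u on
  ... | v , p≤v , _ , on′ = N v p≤v on′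

  leftmostOn-transfer : ∀ {p e i} → p ≤ a → t i ≡ s i → LeftmostOn t p e i → LeftmostOn s p e i
  leftmostOn-transfer p≤a t≡s L = leftmostOn (from L) (onDiagonal-resize t≡s (hit L)) skipped′
    where
    skipped′ : ∀ u → _ ≤ u → u < _ → ¬ OnDiagonal s u _
    skipped′ u p≤u u<i on with onDiagonal-s⇒t p≤a p≤u on
    ... | v , p≤v , v≤u , on′ = skipped L v p≤v (≤-<-trans v≤u u<i) on′

  ¬leftmostOn-next : ∀ {p e} → p ≤ a → ¬ LeftmostOn t p e (suc a)
  ¬leftmostOn-next p≤a L = skipped L a p≤a (n<1+n a)
    (onDiagonal-t-at (<⇒≤ (onDiagonal⇒≤ {t} (hit L)))
                     (≤-trans (onDiagonal-t-next⇒≤ (hit L)) (+-monoʳ-≤ a x≤y)))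

  noneOn-s-upTo : ∀ {p e} → e ≤ suc a → (∀ u → p ≤ u → u < a → ¬ OnDiagonal s u e) →
                  ¬ OnDiagonal s a e → ¬ OnDiagonal s (suc a) e → NoneOn s p e
  noneOn-s-upTo {e = e} e≤ lower ¬at ¬next u p≤u on with around a u
  ... | below u<a   = lower u p≤u u<a on
  ... | at          = ¬at on
  ... | next        = ¬next on
  ... | above a+1<u = ¬onDiagonal-beyond (≤-<-trans e≤ a+1<u) on

  module _ {p d : ℕ} (L : LeftmostOn t p d a) where

    skipped-s-below : ∀ u → p ≤ u → u < a → ¬ OnDiagonal s u d
    skipped-s-below u p≤u u<a on = skipped L u p≤u u<a (onDiagonal-resize (sym (t≡s-below u<a)) on)

    leftmostOn-s-at : OnDiagonal s a d → LeftmostOn s p d a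
    leftmostOn-s-at on = leftmostOn (from L) on skipped-s-below

    leftmostOn-s-next : ¬ OnDiagonal s a d → OnDiagonal s (suc a) d → LeftmostOn s p d (suc a)
    leftmostOn-s-next ¬at on = leftmostOn (≤-trans (from L) (n≤1+n a)) on skipped′
      where
      skipped′ : ∀ u → p ≤ u → u < suc a → ¬ OnDiagonal s u d
      skipped′ u p≤u u<a+1 with m≤n⇒m<n∨m≡n (≤-pred u<a+1)
      ... | inj₁ u<a  = skipped-s-below u p≤u u<a
      ... | inj₂ refl = ¬at

  simulate-S2a-at : ∀ {d p} → p ≤ a → LeftmostOn t p d a → a + t a ≤ suc d → Simulated (suc d) p a
  simulate-S2a-at {d} {p} p≤a L top with s (suc a) ≟ 0
  ... | no y≢0 = moved-up (S2a (leftmostOn-s-next L (¬onDiagonal-s-at (≤-trans (+-monoʳ-≤ a x≤y) a+y≤d)) on-next)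
                               (s≤s a+y≤d))
    where
    a+y≤d : a + s (suc a) ≤ d
    a+y≤d = ≤-pred (subst (_≤ suc d) a+t-at top)
    on-next : OnDiagonal s (suc a) d
    on-next = cell (s≤s z≤n) (≤-trans (m<m+n a (n≢0⇒n>0 y≢0)) a+y≤d) (s≤s (onDiagonal-t-at⇒≤ (hit L)))
  ... | yes y≡0
    with ≤-antisym (≤-trans (onDiagonal-t-at⇒≤ (hit L)) (≤-reflexive (a+n≡a y≡0))) (onDiagonal⇒≤ (hit L))
  ...   | refl = moved-up (S1a (noneOn-s-upTo (n≤1+n a) (skipped-s-below L) (¬onDiagonal-s-at a+x≤a)
                                              (¬onDiagonal-beyond (n<1+n a)))
                               (noneOn-s-upTo ≤-refl lower (¬onDiagonal-s-at (m≤n⇒m≤1+n a+x≤a)) ¬next))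
    where
    a+x≤a : a + s a ≤ a
    a+x≤a = ≤-trans (+-monoʳ-≤ a x≤y) (≤-reflexive (a+n≡a y≡0))
    ¬next : ¬ OnDiagonal s (suc a) (suc a)
    ¬next (cell _ _ a<a+y) = <⇒≱ a<a+y (s≤s (≤-reflexive (a+n≡a y≡0)))
    lower : ∀ u → p ≤ u → u < a → ¬ OnDiagonal s u (suc a)
    lower u p≤u u<a on = skipped-s-below L u p≤u u<a (onDiagonal-pred (m<n⇒m<1+n u<a) on)

  simulate-S1c-at : ∀ {p r} → p ≤ a → NoneOn t p (a ∸ 1) → 2 ≤ t a →
                    Slides t (suc a) (suc a) r → Simulated a p r
  simulate-S1c-at {p} p≤a N 2≤ta (S1a _ N′) with s a ≟ 0
  ... | no x≢0 = ⊥-elim (N′ (suc a) ≤-refl (onDiagonal-t-next ≤-refl (m<m+n a (n≢0⇒n>0 x≢0))))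
  ... | yes x≡0 = moved-down (S1a (noneOn-transfer p≤a N)
                                  (noneOn-s-upTo (n≤1+n a) lower (¬onDiagonal-s-at (≤-reflexive (a+n≡a x≡0)))
                                                 (¬onDiagonal-beyond (n<1+n a))))
                             (subst (_< s (suc a)) (sym x≡0) (≤-pred (subst (2 ≤_) t-at 2≤ta)))
    where
    lower : ∀ u → p ≤ u → u < a → ¬ OnDiagonal s u a
    lower u p≤u u<a on = N u p≤u (onDiagonal-pred u<a (onDiagonal-resize (sym (t≡s-below u<a)) on))
  simulate-S1c-at p≤a N 2≤ta (S1c _ _ _ 2≤t-next D) =
    unmoved-above (Slides-start≤result D ≤-refl)
      (S1c 1≤a p≤a (noneOn-transfer p≤a N) 2≤x
        (S1c (s≤s z≤n) ≤-refl (noneOn-beyond (n<1+n a)) (≤-trans 2≤x x≤y)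
          (Slides-agree (λ _ → t≡s-above) ≤-refl D)))
    where 2≤x = subst (2 ≤_) t-next 2≤t-next
  simulate-S1c-at _ _ _ (S2a L _)   = ⊥-elim (noneOn-beyond (n<1+n a) _ (from L) (hit L))
  simulate-S1c-at _ _ _ (S2c L _ _) = ⊥-elim (noneOn-beyond (n<1+n a) _ (from L) (hit L))

  module _ {d p : ℕ} (p≤a : p ≤ a) (L : LeftmostOn t p d a) (tall : suc (suc d) < a + t a) where

    private
      a≤d : a ≤ d
      a≤d = onDiagonal⇒≤ (hit L)

      2+d≤a+y : suc (suc d) ≤ a + s (suc a)
      2+d≤a+y = ≤-pred (subst (suc (suc d) <_) a+t-at tall)

      t-next-on : suc d ≤ a + s a → OnDiagonal t (suc a) (suc d)
      t-next-on = onDiagonal-t-next (s≤s a≤d)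

      on-next : ∀ {e} → a < e → e ≤ suc d → OnDiagonal s (suc a) e
      on-next a<e e≤ = cell (s≤s z≤n) a<e (s≤s (≤-trans e≤ (≤-trans (n≤1+n _) 2+d≤a+y)))

    simulate-S2c-at-inside : ∀ {r} → suc d ≤ a + s a → Slides t (suc (suc d)) (suc a) r → Simulated (suc d) p r
    simulate-S2c-at-inside 1+d≤a+x (S1a N _)       = ⊥-elim (N (suc a) ≤-refl (t-next-on 1+d≤a+x))
    simulate-S2c-at-inside 1+d≤a+x (S1c _ _ N _ _) = ⊥-elim (N (suc a) ≤-refl (t-next-on 1+d≤a+x))
    simulate-S2c-at-inside 1+d≤a+x (S2a L′ top) with leftmostOn-unique L′ (leftmostOn-here (t-next-on 1+d≤a+x))
    ... | refl = moved-down (S2a (leftmostOn-s-at L (cell 1≤a a≤d 1+d≤a+x)) a+x≤1+d)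
                   (+-cancelˡ-< a _ _ (≤-trans (s≤s a+x≤1+d) 2+d≤a+y))
      where a+x≤1+d = ≤-pred (subst (λ h → suc a + h ≤ suc (suc d)) t-next top)
    simulate-S2c-at-inside 1+d≤a+x (S2c L′ tall′ D′)
      with leftmostOn-unique L′ (leftmostOn-here (t-next-on 1+d≤a+x))
    ... | refl = unmoved-above (Slides-start≤result D′ (s≤s (s≤s (≤-trans a≤d (n≤1+n d)))))
                   (S2c (leftmostOn-s-at L (cell 1≤a a≤d 1+d≤a+x)) 3+d≤a+x
                     (S2c (leftmostOn-here (on-next (s≤s a≤d) ≤-refl))
                          (s≤s (≤-trans 3+d≤a+x (+-monoʳ-≤ a x≤y)))
                       (Slides-agree (λ _ → t≡s-above) ≤-refl D′)))
      where 3+d≤a+x = ≤-pred (subst (λ h → suc (suc (suc d)) < suc a + h) t-next tall′)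

    simulate-S2c-at-beyond : ∀ {r} → a + s a ≤ d → Slides t (suc (suc d)) (suc a) r → Simulated (suc d) p r
    simulate-S2c-at-beyond {r} a+x≤d D =
      unmoved-above (Slides-start≤result D′ (s≤s (s≤s a≤d))) (first-step (m≤n⇒m<n∨m≡n a≤d))
      where
      ¬at = ¬onDiagonal-s-at a+x≤d
      ¬t-next : ∀ {e} → d < e → ¬ OnDiagonal t (suc a) e
      ¬t-next d<e on = <⇒≱ d<e (≤-trans (onDiagonal-t-next⇒≤ on) a+x≤d)
      D′ : Slides t (suc (suc d)) (suc (suc a)) r
      D′ = Slides-skip D (¬t-next (n<1+n d)) (¬t-next (m<n⇒m<1+n (n<1+n d)))
      D″ : Slides s (suc (suc d)) (suc (suc a)) r
      D″ = Slides-agree (λ _ → t≡s-above) ≤-refl D′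
      first-step : a < d ⊎ a ≡ d → Slides s (suc d) p r
      first-step (inj₁ a<d)  = S2c (leftmostOn-s-next L ¬at (on-next a<d (n≤1+n d))) (s≤s 2+d≤a+y) D″
      first-step (inj₂ refl) =
        S1c (s≤s z≤n) (≤-trans p≤a (n≤1+n a))
            (noneOn-s-upTo (n≤1+n a) (skipped-s-below L) ¬at (¬onDiagonal-beyond (n<1+n a)))
            (+-cancelˡ-≤ a 2 _ (subst (_≤ a + s (suc a)) (+-comm 2 a) 2+d≤a+y)) D″

  simulate : ∀ {d p r} → Slides t (suc d) p r → p ≤ a → Simulated (suc d) p r
  simulate {d} (S1a N N′) p≤a with around a (suc d)
  ... | below d<a   = unmoved-below d<a (S1a (noneOn-transfer p≤a N) (noneOn-transfer p≤a N′))
  ... | above a+1<d = unmoved-above a+1<d (S1a (noneOn-transfer p≤a N) (noneOn-transfer p≤a N′))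
  ... | at          = ⊥-elim (N′ a p≤a (onDiagonal-t-at ≤-refl (m≤m+n a _)))
  ... | next        = ⊥-elim (N a p≤a (onDiagonal-t-at ≤-refl (m≤m+n a _)))
  simulate (S2a {i = i} L top) p≤a with around a i
  ... | below i<a   = unmoved-below i<a (S2a (leftmostOn-transfer p≤a t≡s L) (subst (λ h → i + h ≤ _) t≡s top))
    where t≡s = t≡s-below i<a
  ... | above a+1<i = unmoved-above a+1<i (S2a (leftmostOn-transfer p≤a t≡s L) (subst (λ h → i + h ≤ _) t≡s top))
    where t≡s = t≡s-above a+1<i
  ... | at          = simulate-S2a-at p≤a L top
  ... | next        = ⊥-elim (¬leftmostOn-next p≤a L)
  simulate {d} (S1c 1≤b p≤b N 2≤tb D) p≤a with around a (suc d)
  ... | below b<a   = Simulated-prepend (S1c 1≤b p≤b (noneOn-transfer p≤a N) (subst (2 ≤_) (t≡s-below b<a) 2≤tb))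
                                        (simulate D b<a)
  ... | above a+1<b = unmoved-above (<-trans a+1<b (Slides-start≤result D ≤-refl))
                        (S1c 1≤b p≤b (noneOn-transfer p≤a N) (subst (2 ≤_) (t≡s-above a+1<b) 2≤tb)
                             (Slides-agree (λ _ → t≡s-above) (<⇒≤ (s≤s a+1<b)) D))
  ... | at          = simulate-S1c-at p≤a N 2≤tb D
  ... | next        = ⊥-elim (N a p≤a (onDiagonal-t-at ≤-refl (m≤m+n a _)))
  simulate {d} (S2c {i = i} L tall D) p≤a with around a i
  ... | below i<a   = Simulated-prepend (S2c (leftmostOn-transfer p≤a t≡s L) (subst (λ h → _ < i + h) t≡s tall))
                                        (simulate D i<a)
    where t≡s = t≡s-below i<a
  ... | above a+1<i = unmoved-above (<-trans a+1<i (Slides-start≤result D (s≤s (m≤n⇒m≤1+n (leftmostOn⇒≤ L)))))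
                        (S2c (leftmostOn-transfer p≤a t≡s L) (subst (λ h → _ < i + h) t≡s tall)
                             (Slides-agree (λ _ → t≡s-above) (<⇒≤ (s≤s a+1<i)) D))
    where t≡s = t≡s-above a+1<i
  ... | next        = ⊥-elim (¬leftmostOn-next p≤a L)
  ... | at with suc d ≤? a + s a
  ...   | yes 1+d≤a+x = simulate-S2c-at-inside p≤a L tall 1+d≤a+x D
  ...   | no  1+d≰a+x = simulate-S2c-at-beyond p≤a L tall (≤-pred (≰⇒> 1+d≰a+x)) D

-- The tableaux of a w and of w

towerAt-[] : ∀ j → towerAt [] j ≡ []
towerAt-[] zero          = refl
towerAt-[] (suc zero)    = refl
towerAt-[] (suc (suc j)) = refl

towerAt-addOnTop-≡ : ∀ X t ℓ → 1 ≤ t → towerAt (addOnTop X t ℓ) t ≡ towerAt X t ++ [ ℓ ]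
towerAt-addOnTop-≡ []      (suc zero)    ℓ _ = refl
towerAt-addOnTop-≡ []      (suc (suc t)) ℓ _ =
  trans (towerAt-addOnTop-≡ [] (suc t) ℓ (s≤s z≤n)) (cong (_++ [ ℓ ]) (towerAt-[] (suc t)))
towerAt-addOnTop-≡ (_ ∷ _) (suc zero)    ℓ _ = refl
towerAt-addOnTop-≡ (_ ∷ X) (suc (suc t)) ℓ _ = towerAt-addOnTop-≡ X (suc t) ℓ (s≤s z≤n)

towerAt-zero : ∀ X → towerAt X 0 ≡ []
towerAt-zero []      = refl
towerAt-zero (_ ∷ _) = refl

towerAt-addOnTop-≢ : ∀ X t ℓ {j} → j ≢ t → towerAt (addOnTop X t ℓ) j ≡ towerAt X j
towerAt-addOnTop-≢ X       t             ℓ {zero}        _   =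
  trans (towerAt-zero (addOnTop X t ℓ)) (sym (towerAt-zero X))
towerAt-addOnTop-≢ []      zero          _ {suc _}       _   = refl
towerAt-addOnTop-≢ (_ ∷ _) zero          _ {suc _}       _   = refl
towerAt-addOnTop-≢ _       (suc zero)    _ {suc zero}    j≢t = ⊥-elim (j≢t refl)
towerAt-addOnTop-≢ []      (suc zero)    _ {suc (suc _)} _   = refl
towerAt-addOnTop-≢ (_ ∷ _) (suc zero)    _ {suc (suc _)} _   = refl
towerAt-addOnTop-≢ []      (suc (suc _)) _ {suc zero}    _   = refl
towerAt-addOnTop-≢ (_ ∷ _) (suc (suc _)) _ {suc zero}    _   = refl
towerAt-addOnTop-≢ []      (suc (suc t)) ℓ {suc (suc j)} j≢t =
  trans (towerAt-addOnTop-≢ [] (suc t) ℓ (j≢t ∘ cong suc)) (towerAt-[] (suc j))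
towerAt-addOnTop-≢ (_ ∷ X) (suc (suc t)) ℓ {suc (suc j)} j≢t =
  towerAt-addOnTop-≢ X (suc t) ℓ (j≢t ∘ cong suc)

size-addOnTop-≡ : ∀ X t ℓ → 1 ≤ t → size (addOnTop X t ℓ) t ≡ suc (size X t)
size-addOnTop-≡ X t ℓ 1≤t =
  trans (cong length (towerAt-addOnTop-≡ X t ℓ 1≤t)) (trans (length-++ (towerAt X t)) (+-comm _ 1))

size-addOnTop-≢ : ∀ X t ℓ {j} → j ≢ t → size (addOnTop X t ℓ) j ≡ size X j
size-addOnTop-≢ X t ℓ j≢t = cong length (towerAt-addOnTop-≢ X t ℓ j≢t)

All-addOnTop : ∀ {P : ℕ → Set} X {t ℓ} → 1 ≤ t → (∀ j → All P (towerAt X j)) → P ℓ →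
               ∀ j → All P (towerAt (addOnTop X t ℓ) j)
All-addOnTop {P} X {t} {ℓ} 1≤t all Pℓ j with j ≟ t
... | yes refl = subst (All P) (sym (towerAt-addOnTop-≡ X t ℓ 1≤t)) (++⁺ (all j) (Pℓ ∷ []))
... | no j≢t   = subst (All P) (sym (towerAt-addOnTop-≢ X _ ℓ j≢t)) (all j)

-- T is obtained from S by undoing steps (1)–(3) with the label 1 in tower a.
record Prepended (a : ℕ) (S T : Tableau) : Set where
  field
    tower-at        : towerAt T a ≡ 1 ∷ map suc (towerAt S (suc a))
    tower-next      : towerAt T (suc a) ≡ map suc (towerAt S a)
    tower-away      : ∀ j → j ≢ a → j ≢ suc a → towerAt T j ≡ map suc (towerAt S j)
    size-at≤next    : size S a ≤ size S (suc a)
    labels-positive : ∀ j → All (1 ≤_) (towerAt S j)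
open Prepended

module _ {a S T} (P : Prepended a S T) where

  size-at : size T a ≡ suc (size S (suc a))
  size-at = trans (cong length (tower-at P)) (cong suc (length-map suc (towerAt S (suc a))))

  size-next : size T (suc a) ≡ size S a
  size-next = trans (cong length (tower-next P)) (length-map suc (towerAt S a))

  size-away : ∀ j → j ≢ a → j ≢ suc a → size T j ≡ size S j
  size-away j j≢a j≢a+1 = trans (cong length (tower-away P j j≢a j≢a+1)) (length-map suc (towerAt S j))

module Growing (S T : Tableau) (k : ℕ) where

  tower-grow : ∀ pre {t t′} → 1 ≤ t → 1 ≤ t′ → towerAt T t ≡ pre ++ map suc (towerAt S t′) →
               towerAt (addOnTop T t (suc k)) t ≡ pre ++ map suc (towerAt (addOnTop S t′ k) t′)
  tower-grow pre {t} {t′} 1≤t 1≤t′ T≡S = begin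
    towerAt (addOnTop T t (suc k)) t              ≡⟨ towerAt-addOnTop-≡ T t (suc k) 1≤t ⟩
    towerAt T t ++ [ suc k ]                      ≡⟨ cong (_++ [ suc k ]) T≡S ⟩
    (pre ++ map suc (towerAt S t′)) ++ [ suc k ]  ≡⟨ ++-assoc pre _ _ ⟩
    pre ++ map suc (towerAt S t′) ++ [ suc k ]    ≡⟨ cong (pre ++_) (sym (map-++ suc (towerAt S t′) [ k ])) ⟩
    pre ++ map suc (towerAt S t′ ++ [ k ])
      ≡⟨ cong (λ xs → pre ++ map suc xs) (sym (towerAt-addOnTop-≡ S t′ k 1≤t′)) ⟩
    pre ++ map suc (towerAt (addOnTop S t′ k) t′) ∎
    where open ≡-Reasoning

  tower-keep : ∀ pre {t t′ j j′} → j ≢ t → j′ ≢ t′ → towerAt T j ≡ pre ++ map suc (towerAt S j′) →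
               towerAt (addOnTop T t (suc k)) j ≡ pre ++ map suc (towerAt (addOnTop S t′ k) j′)
  tower-keep pre {t} {t′} j≢t j′≢t′ T≡S =
    trans (towerAt-addOnTop-≢ T t (suc k) j≢t)
          (trans T≡S (cong (λ xs → pre ++ map suc xs) (sym (towerAt-addOnTop-≢ S t′ k j′≢t′))))

module _ {a S T k} (1≤a : 1 ≤ a) (1≤k : 1 ≤ k) (P : Prepended a S T) where

  open Growing S T k

  private
    a≢a+1 : a ≢ suc a
    a≢a+1 = <⇒≢ (n<1+n a)

  Prepended-grow-at : Prepended a (addOnTop S (suc a) k) (addOnTop T a (suc k))
  Prepended-grow-at = record
    { tower-at        = tower-grow [ 1 ] 1≤a (s≤s z≤n) (tower-at P)
    ; tower-next      = tower-keep [] (≢-sym a≢a+1) a≢a+1 (tower-next P)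
    ; tower-away      = λ j j≢a j≢a+1 → tower-keep [] j≢a j≢a+1 (tower-away P j j≢a j≢a+1)
    ; size-at≤next    = ≤-trans (≤-reflexive (size-addOnTop-≢ S (suc a) k a≢a+1))
                          (≤-trans (m≤n⇒m≤1+n (size-at≤next P))
                                   (≤-reflexive (sym (size-addOnTop-≡ S (suc a) k (s≤s z≤n)))))
    ; labels-positive = All-addOnTop S (s≤s z≤n) (labels-positive P) 1≤k
    }

  Prepended-grow-next : size S a < size S (suc a) → Prepended a (addOnTop S a k) (addOnTop T (suc a) (suc k))
  Prepended-grow-next grows = record
    { tower-at        = tower-keep [ 1 ] a≢a+1 (≢-sym a≢a+1) (tower-at P)
    ; tower-next      = tower-grow [] (s≤s z≤n) 1≤a (tower-next P)
    ; tower-away      = λ j j≢a j≢a+1 → tower-keep [] j≢a+1 j≢a (tower-away P j j≢a j≢a+1)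
    ; size-at≤next    = ≤-trans (≤-reflexive (size-addOnTop-≡ S a k 1≤a))
                          (≤-trans grows (≤-reflexive (sym (size-addOnTop-≢ S a k (≢-sym a≢a+1)))))
    ; labels-positive = All-addOnTop S 1≤a (labels-positive P) 1≤k
    }

  Prepended-grow-away : ∀ {r} → 1 ≤ r → r ≢ a → r ≢ suc a →
                        Prepended a (addOnTop S r k) (addOnTop T r (suc k))
  Prepended-grow-away {r} 1≤r r≢a r≢a+1 = record
    { tower-at        = tower-keep [ 1 ] (≢-sym r≢a) (≢-sym r≢a+1) (tower-at P)
    ; tower-next      = tower-keep [] (≢-sym r≢a+1) (≢-sym r≢a) (tower-next P)
    ; tower-away      = tower-away′
    ; size-at≤next    = subst₂ _≤_ (sym (size-addOnTop-≢ S r k (≢-sym r≢a)))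
                                   (sym (size-addOnTop-≢ S r k (≢-sym r≢a+1))) (size-at≤next P)
    ; labels-positive = All-addOnTop S 1≤r (labels-positive P) 1≤k
    }
    where
    tower-away′ : ∀ j → j ≢ a → j ≢ suc a →
                  towerAt (addOnTop T r (suc k)) j ≡ map suc (towerAt (addOnTop S r k) j)
    tower-away′ j j≢a j≢a+1 with j ≟ r
    ... | yes refl = tower-grow [] 1≤r 1≤r (tower-away P j j≢a j≢a+1)
    ... | no j≢r   = tower-keep [] j≢r j≢r (tower-away P j j≢a j≢a+1)

open Transposition using (moved-up; moved-down; unmoved)

Prepended-slide : ∀ {a S T b r k} → 1 ≤ a → 1 ≤ b → 1 ≤ k → Prepended a S T → slideInto b T ≡ just r →
                  Σ ℕ λ r′ → slideInto b S ≡ just r′ × Prepended a (addOnTop S r′ k) (addOnTop T r (suc k))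
Prepended-slide {a} {S} {T} {suc d} 1≤a _ 1≤k P eq
  with Transposition.simulate 1≤a (size-at P) (size-next P) (size-away P) (size-at≤next P)
         (slide-sound (suc (suc (length T))) (suc d) 1 T eq) 1≤a
... | moved-up D          = suc a , slideInto-complete S D , Prepended-grow-at 1≤a 1≤k P
... | moved-down D grows  = a , slideInto-complete S D , Prepended-grow-next 1≤a 1≤k P grows
... | unmoved r≢a r≢a+1 D =
  _ , slideInto-complete S D , Prepended-grow-away 1≤a 1≤k P (Slides-start≤result D (s≤s z≤n)) r≢a r≢a+1

insertWord-cons : ∀ {k S b bs r} → slideInto b S ≡ just r →
                  insertWord k S (b ∷ bs) ≡ insertWord (suc k) (addOnTop S r k) bs
insertWord-cons eq rewrite eq = refl

insertWord-cons⁻ : ∀ {k T b bs T*} → insertWord k T (b ∷ bs) ≡ just T* →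
                   Σ ℕ λ r → slideInto b T ≡ just r × insertWord (suc k) (addOnTop T r k) bs ≡ just T*
insertWord-cons⁻ {k} {T} {b} eq with slideInto b T
... | just r = r , refl , eq

Prepended-insertWord : ∀ {a S T T*} w {k} → 1 ≤ a → All (1 ≤_) w → 1 ≤ k → Prepended a S T →
                       insertWord (suc k) T w ≡ just T* →
                       Σ Tableau λ S* → insertWord k S w ≡ just S* × Prepended a S* T*
Prepended-insertWord {S = S} [] _ _ _ P refl = S , refl , P
Prepended-insertWord {S = S} {T} (b ∷ w) {k} 1≤a (1≤b ∷ 1≤w) 1≤k P eq
  with insertWord-cons⁻ {suc k} {T} {b} {w} eq
... | r , slide-T , eq′ with Prepended-slide 1≤a 1≤b 1≤k P slide-T
...   | r′ , slide-S , P′ with Prepended-insertWord w 1≤a 1≤w (s≤s z≤n) P′ eq′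
...     | S* , eq-S* , P* = S* , trans (insertWord-cons {k} {S} {b} {w} slide-S) eq-S* , P*

size-[] : ∀ j → size [] j ≡ 0
size-[] j = cong length (towerAt-[] j)

slideInto-[] : ∀ {a} → 1 ≤ a → slideInto a [] ≡ just a
slideInto-[] 1≤a = slideInto-complete [] (S1a empty empty)
  where
  empty : ∀ {e} → NoneOn (size []) 1 e
  empty u _ on = n≮0 (subst (0 <_) (size-[] u) (onDiagonal⇒nonempty on))

Prepended-initial : ∀ {a} → 1 ≤ a → Prepended a [] (addOnTop [] a 1)
Prepended-initial {a} 1≤a = record
  { tower-at        = towerAt-addOnTop-≡ [] a 1 1≤a
  ; tower-next      = trans (towerAt-addOnTop-≢ [] a 1 (>⇒≢ (n<1+n a))) (towerAt-[] (suc a))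
  ; tower-away      = λ j j≢a _ → trans (towerAt-addOnTop-≢ [] a 1 j≢a) (towerAt-[] j)
  ; size-at≤next    = ≤-reflexive (size-[] a)
  ; labels-positive = λ j → subst (All _) (sym (towerAt-[] j)) []
  }

1∉map-suc : ∀ {xs} → All (1 ≤_) xs → 1 ∉ map suc xs
1∉map-suc ps 1∈ with ∈-map⁻ suc 1∈
... | _ , 0∈xs , refl with All.lookup ps 0∈xs
...   | ()

Prepended-1∈⇒≡ : ∀ {a S T i} → Prepended a S T → 1 ∈ towerAt T i → i ≡ a
Prepended-1∈⇒≡ {a} {i = i} P 1∈ with i ≟ a | i ≟ suc a
... | yes i≡a | _        = i≡a
... | no _    | yes refl = ⊥-elim (1∉map-suc (labels-positive P a) (subst (1 ∈_) (tower-next P) 1∈))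
... | no i≢a  | no i≢a+1 =
  ⊥-elim (1∉map-suc (labels-positive P i) (subst (1 ∈_) (tower-away P i i≢a i≢a+1) 1∈))

map-pred-map-suc : ∀ xs → map pred (map suc xs) ≡ xs
map-pred-map-suc xs = trans (sym (map-∘ xs)) (map-id xs)

removeLabel-map-suc : ∀ {xs} → All (1 ≤_) xs → removeLabel 1 (map suc xs) ≡ map suc xs
removeLabel-map-suc ps = filter-all (λ x → ¬? (x ≟ 1)) (map⁺ (All.map (λ { (s≤s _) () }) ps))

Prepended⇒transformed : ∀ {a S T} → Prepended a S T → ∀ j → towerAt S j ≡ transformedTower T a j
Prepended⇒transformed {a} {S} {T} P j with j ≟ a | j ≟ suc a
... | yes refl | _ rewrite ≡⇒≡ᵇ≡true (refl {x = j}) =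
  sym (trans (cong (map pred) (tower-next P)) (map-pred-map-suc _))
... | no j≢a | yes refl rewrite ≢⇒≡ᵇ≡false j≢a | ≡⇒≡ᵇ≡true (refl {x = j}) = sym (begin
  map pred (removeLabel 1 (towerAt T a))              ≡⟨ cong (map pred ∘ removeLabel 1) (tower-at P) ⟩
  map pred (removeLabel 1 (map suc (towerAt S j)))    ≡⟨ cong (map pred) (removeLabel-map-suc (labels-positive P j)) ⟩
  map pred (map suc (towerAt S j))                    ≡⟨ map-pred-map-suc _ ⟩
  towerAt S j                                         ∎)
  where open ≡-Reasoning
... | no j≢a | no j≢a+1 rewrite ≢⇒≡ᵇ≡false j≢a | ≢⇒≡ᵇ≡false j≢a+1 =
  sym (trans (cong (map pred) (tower-away P j j≢a j≢a+1)) (map-pred-map-suc _))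

mainTheorem1 : (a : ℕ) (α′ : List ℕ) → All (1 ≤_) (a ∷ α′) →
    (T : Tableau) → standardTableau (a ∷ α′) ≡ just T →
    (i : ℕ) → 1 ≤ i → 1 ∈ towerAt T i →
    Σ Tableau (λ S → (standardTableau α′ ≡ just S) ×
    ((j : ℕ) → towerAt S j ≡ transformedTower T i j))
mainTheorem1 a α′ (1≤a ∷ 1≤α′) T eq i _ 1∈Tᵢ
  with Prepended-insertWord α′ 1≤a 1≤α′ (s≤s z≤n) (Prepended-initial 1≤a)
         (trans (sym (insertWord-cons {1} {[]} {a} {α′} (slideInto-[] 1≤a))) eq)
... | S , S-eq , P with Prepended-1∈⇒≡ P 1∈Tᵢ
...   | refl = S , S-eq , Prepended⇒transformed P
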